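{- For each $N\in\{23,50,77,178,232\}$, the elementary cellular automaton $F_N$ satisfies $D(\textsc{Pred}_{F_N,n})\in O(\log n)$.
   Context: The ECA with Wolfram number $N$ is $F_N:\{0,1\}^{\mathbb{Z}}\to\{0,1\}^{\mathbb{Z}}$, $(F_N(x))_i=f_N(x_{i-1},x_i,x_{i+1})$, where $f_N(a,b,c)$ is the bit of index $4a+2b+c$ of $N$ in binary. On a finite word of length $m$, $F_N$ returns the word of length $m-2$ obtained by applying $f_N$ wherever it is defined. $\textsc{Pred}_{F,n}:\{0,1\}^{2n+1}\to\{0,1\}$ maps $x$ to the unique cell of $F^n(x)$. For finite sets $X,Y,Z$ and $g:X\times Y\to Z$, $D(g)$ is the minimal depth of a deterministic two-party communication protocol tree computing $g$ (Alice knows $x$, Bob knows $y$; internal nodes are labelled by a function of $x$ alone or of $y$ alone to $\{\mathrm{l},\mathrm{r}\}$ selecting the child, leaves are labelled by outputs). For $g:\{0,1\}^m\to Z$, $D(g)=\max_{0\le i\le m} D(g_i)$ where $g_i:\{0,1\}^i\times\{0,1\}^{m-i}\to Z$, $g_i(x,y)=g(xy)$. -}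

module Defs where

open import Data.Bool using (Bool; true; false; if_then_else_)
open import Data.Nat using (ℕ; zero; suc; _+_; _*_; _≤_; _⊔_; ⌊_/2⌋; _≡ᵇ_)
open import Data.Nat.Base using (_%_)
open import Data.Vec using (Vec; []; _∷_; _++_; head)
open import Data.Product using (Σ; _×_)
open import Relation.Binary.PropositionalEquality using (_≡_; subst)

bitAt : ℕ → ℕ → Bool
bitAt N zero    = (N % 2) ≡ᵇ 1
bitAt N (suc k) = bitAt ⌊ N /2⌋ k

toℕ𝔹 : Bool → ℕ
toℕ𝔹 false = 0
toℕ𝔹 true  = 1

localRule : ℕ → Bool → Bool → Bool → Bool
localRule N a b c = bitAt N (4 * toℕ𝔹 a + 2 * toℕ𝔹 b + toℕ𝔹 c)

step : ℕ → ∀ {m} → Vec Bool (suc (suc m)) → Vec Bool m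
step N {zero}  _                   = []
step N {suc m} (a ∷ b ∷ c ∷ rest) = localRule N a b c ∷ step N (b ∷ c ∷ rest)

-- twice n = 2n (by recursion, so that lengths reduce definitionally)
twice : ℕ → ℕ
twice zero    = zero
twice (suc n) = suc (suc (twice n))

iterF : ℕ → (n : ℕ) → ∀ {m} → Vec Bool (twice n + m) → Vec Bool m
iterF N zero    v = v
iterF N (suc n) v = iterF N n (step N v)

Pred : ℕ → (n : ℕ) → Vec Bool (twice n + 1) → Bool
Pred N n x = head (iterF N n x)

data Protocol (X Y Z : Set) : Set where
  leaf  : Z → Protocol X Y Z
  alice : (X → Bool) → Protocol X Y Z → Protocol X Y Z → Protocol X Y Z
  bob   : (Y → Bool) → Protocol X Y Z → Protocol X Y Z → Protocol X Y Z

run : ∀ {X Y Z} → Protocol X Y Z → X → Y → Z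
run (leaf z)      x y = z
run (alice f l r) x y = if f x then run r x y else run l x y
run (bob f l r)   x y = if f y then run r x y else run l x y

depth : ∀ {X Y Z} → Protocol X Y Z → ℕ
depth (leaf _)      = 0
depth (alice _ l r) = suc (depth l ⊔ depth r)
depth (bob _ l r)   = suc (depth l ⊔ depth r)

Computes : ∀ {X Y Z} → Protocol X Y Z → (X → Y → Z) → Set
Computes p g = ∀ x y → run p x y ≡ g x y

-- D(g) ≤ d for g : X × Y → Z  (the minimum depth is ≤ d iff some protocol of depth ≤ d computes g)
D₂≤ : ∀ {X Y Z : Set} → (X → Y → Z) → ℕ → Set
D₂≤ {X} {Y} {Z} g d = Σ (Protocol X Y Z) λ p → depth p ≤ d × Computes p g

-- D(g) ≤ d for g : {0,1}^m → Z : D(g_i) ≤ d for every split m = i + j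
D≤ : ∀ {Z : Set} {m : ℕ} → (Vec Bool m → Z) → ℕ → Set
D≤ {Z} {m} g d = ∀ i j (e : i + j ≡ m) →
  D₂≤ (λ (x : Vec Bool i) (y : Vec Bool j) → g (subst (Vec Bool) e (x ++ y))) d

-- Each of these rules has shields: adjacent pairs (a, σ a), with σ = id for 23 and 232 and
-- σ = not for 50, 77 and 178, which one step maps to a shield at the same place without looking
-- at the cells outside the pair. A shield at offset k ≤ n therefore hides everything to its left
-- from the cell computed after n steps, while a word without shields is determined by its first
-- letter, each letter b being followed by not (σ b). So when Alice's half of the input has length
-- at most n she only needs to send the offset of her last shield and the two cells there, that is
-- O(log n) bits, after which Bob knows the answer. Otherwise Bob's half is that short, and since
-- the rules are mirror-symmetric the roles can be exchanged.
module Submission where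

open import Defs
open import Data.Nat using (ℕ; _*_; _≤_)
open import Data.Nat.Logarithm using (⌊log₂_⌋)
open import Data.List using (List; _∷_; [])
open import Data.List.Membership.Propositional using (_∈_)
open import Data.Product using (Σ)

open import Data.Bool using (Bool; true; false; not; _∨_; if_then_else_)
open import Data.Bool.Properties using (_≟_; ¬-not; ∨-conicalˡ; ∨-conicalʳ; ∨-identityʳ)
open import Data.List using (length; _++_; reverse)
import Data.List as List
open import Data.List.Properties
  using (length-++; length-reverse; reverse-++; reverse-involutive; unfold-reverse)
open import Data.List.Relation.Unary.Any using (here; there)
open import Data.Maybe using (fromMaybe)
open import Data.Nat using (zero; suc; _+_; _∸_; _^_; _<_; _≰_; s≤s; z≤n; _⊔_; ⌊_/2⌋)
open import Data.Nat.Properties hiding (_≟_)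
open import Data.Nat.Logarithm using (⌊log₂⌋-mono-≤; ⌊log₂[2^n]⌋≡n)
open import Data.Product using (_,_)
open import Data.Vec using (Vec; _∷_; []; head; tail; toList)
import Data.Vec as Vec
open import Data.Vec.Properties using (toList-++; length-toList)
open import Function using (_∘_; flip; id)
open import Relation.Nullary using (Dec; yes; no; does)
open import Relation.Nullary.Decidable using (True; toWitness; map′; _×-dec_)
open import Relation.Binary.PropositionalEquality
  using (_≡_; refl; sym; trans; cong; cong₂; subst; subst₂; module ≡-Reasoning)

D₂≤-cong : ∀ {X Y Z : Set} {g h : X → Y → Z} {d} →
  (∀ x y → g x y ≡ h x y) → D₂≤ g d → D₂≤ h d
D₂≤-cong g≗h (p , depth≤ , p⊢g) = p , depth≤ , λ x y → trans (p⊢g x y) (g≗h x y)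

D₂≤-mono : ∀ {X Y Z : Set} {g : X → Y → Z} {d d′} → d ≤ d′ → D₂≤ g d → D₂≤ g d′
D₂≤-mono d≤d′ (p , depth≤ , p⊢g) = p , ≤-trans depth≤ d≤d′ , p⊢g

exchangeRoles : ∀ {X Y Z} → Protocol X Y Z → Protocol Y X Z
exchangeRoles (leaf z)      = leaf z
exchangeRoles (alice f l r) = bob f (exchangeRoles l) (exchangeRoles r)
exchangeRoles (bob f l r)   = alice f (exchangeRoles l) (exchangeRoles r)

depth-exchangeRoles : ∀ {X Y Z} (p : Protocol X Y Z) → depth (exchangeRoles p) ≡ depth p
depth-exchangeRoles (leaf z)      = refl
depth-exchangeRoles (alice f l r) = cong₂ (λ a b → suc (a ⊔ b)) (depth-exchangeRoles l) (depth-exchangeRoles r)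
depth-exchangeRoles (bob f l r)   = cong₂ (λ a b → suc (a ⊔ b)) (depth-exchangeRoles l) (depth-exchangeRoles r)

run-exchangeRoles : ∀ {X Y Z} (p : Protocol X Y Z) x y → run (exchangeRoles p) y x ≡ run p x y
run-exchangeRoles (leaf z)      x y = refl
run-exchangeRoles (alice f l r) x y with f x
... | false = run-exchangeRoles l x y
... | true  = run-exchangeRoles r x y
run-exchangeRoles (bob f l r)   x y with f y
... | false = run-exchangeRoles l x y
... | true  = run-exchangeRoles r x y

D₂≤-flip : ∀ {X Y Z : Set} {g : X → Y → Z} {d} → D₂≤ g d → D₂≤ (flip g) d
D₂≤-flip (p , depth≤ , p⊢g) =
  exchangeRoles p ,
  subst (_≤ _) (sym (depth-exchangeRoles p)) depth≤ ,
  λ y x → trans (run-exchangeRoles p x y) (p⊢g x y)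

D₂≤-bobAnswers : ∀ {X Y : Set} (h : Y → Bool) → D₂≤ (λ (_ : X) y → h y) 1
D₂≤-bobAnswers h = bob h (leaf false) (leaf true) , ≤-refl , correct
  where
    correct : ∀ x y → run (bob h (leaf false) (leaf true)) x y ≡ h y
    correct x y with h y
    ... | false = refl
    ... | true  = refl

D₂≤-aliceSends : ∀ {X Y Z : Set} {d} (b : X → Bool) (g : Bool → X → Y → Z) →
  D₂≤ (g false) d → D₂≤ (g true) d → D₂≤ (λ x y → g (b x) x y) (suc d)
D₂≤-aliceSends b g (l , l≤ , l⊢g) (r , r≤ , r⊢g) = alice b l r , s≤s (⊔-lub l≤ r≤) , correct
  where
    correct : ∀ x y → run (alice b l r) x y ≡ g (b x) x y
    correct x y with b x
    ... | false = l⊢g x y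
    ... | true  = r⊢g x y

D₂≤-oneWay : ∀ {X Y : Set} B (c : X → Vec Bool B) (h : Vec Bool B → Y → Bool) →
  D₂≤ (λ x y → h (c x) y) (suc B)
D₂≤-oneWay zero c h = D₂≤-cong (λ x y → cong (λ v → h v y) (empty (c x))) (D₂≤-bobAnswers (h []))
  where
    empty : (v : Vec Bool 0) → [] ≡ v
    empty [] = refl
D₂≤-oneWay (suc B) c h =
  D₂≤-cong (λ x y → cong (λ v → h v y) (head∷tail (c x)))
    (D₂≤-aliceSends (head ∘ c) (λ b x → h (b ∷ tail (c x)))
      (D₂≤-oneWay B (tail ∘ c) (h ∘ (false ∷_)))
      (D₂≤-oneWay B (tail ∘ c) (h ∘ (true ∷_))))
  where
    head∷tail : (v : Vec Bool (suc B)) → head v ∷ tail v ≡ v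
    head∷tail (b ∷ v) = refl

twice≡+ : ∀ n → twice n ≡ n + n
twice≡+ zero    = refl
twice≡+ (suc n) = cong suc (trans (cong suc (twice≡+ n)) (sym (+-suc n n)))

twice≡2* : ∀ n → twice n ≡ 2 * n
twice≡2* n = trans (twice≡+ n) (cong (n +_) (sym (+-identityʳ n)))

k+[2+m]≡1+2n∧k≤n⇒k≤1+m : ∀ {k m n} → k + suc (suc m) ≡ suc (twice n) → k ≤ n → k ≤ suc m
k+[2+m]≡1+2n∧k≤n⇒k≤1+m {k} {m} {n} length≡ k≤n = +-cancelˡ-≤ k k (suc m) (begin
    k + k      ≤⟨ +-mono-≤ k≤n k≤n ⟩
    n + n      ≡⟨ twice≡+ n ⟨
    twice n    ≡⟨ suc-injective (trans (sym length≡) (+-suc k (suc m))) ⟩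
    k + suc m  ∎)
  where open ≤-Reasoning

n+m≡2k+1∧n≰k⇒m≤k : ∀ {n m k} → n + m ≡ twice k + 1 → n ≰ k → m ≤ k
n+m≡2k+1∧n≰k⇒m≤k {n} {m} {k} length≡ n≰k = +-cancelˡ-≤ (suc k) m k (begin
    suc k + m      ≤⟨ +-monoˡ-≤ m (≰⇒> n≰k) ⟩
    n + m          ≡⟨ length≡ ⟩
    twice k + 1    ≡⟨ +-comm (twice k) 1 ⟩
    suc (twice k)  ≡⟨ cong suc (twice≡+ k) ⟩
    suc k + k      ∎)
  where open ≤-Reasoning

4+n≤5*n : ∀ {n} → 1 ≤ n → 4 + n ≤ 5 * n
4+n≤5*n {n} 1≤n = subst (_≤ 5 * n) (+-comm n 4) (+-monoʳ-≤ n (*-monoʳ-≤ 4 1≤n))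

odd : ℕ → Bool
odd zero          = false
odd (suc zero)    = true
odd (suc (suc n)) = odd n

toBits : ∀ B → ℕ → Vec Bool B
toBits zero    n = []
toBits (suc B) n = odd n ∷ toBits B ⌊ n /2⌋

fromBits : ∀ {B} → Vec Bool B → ℕ
fromBits []      = 0
fromBits (b ∷ v) = toℕ𝔹 b + twice (fromBits v)

odd+twice⌊n/2⌋≡n : ∀ n → toℕ𝔹 (odd n) + twice ⌊ n /2⌋ ≡ n
odd+twice⌊n/2⌋≡n zero          = refl
odd+twice⌊n/2⌋≡n (suc zero)    = refl
odd+twice⌊n/2⌋≡n (suc (suc n)) =
  trans (+-suc _ _) (cong suc (trans (+-suc _ _) (cong suc (odd+twice⌊n/2⌋≡n n))))

⌊n/2⌋<m : ∀ {n} m → n < twice m → ⌊ n /2⌋ < m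
⌊n/2⌋<m {zero}        (suc m) _                 = s≤s z≤n
⌊n/2⌋<m {suc zero}    (suc m) _                 = s≤s z≤n
⌊n/2⌋<m {suc (suc n)} (suc m) (s≤s (s≤s n<2m)) = s≤s (⌊n/2⌋<m m n<2m)

fromBits-toBits : ∀ B {n} → n < 2 ^ B → fromBits (toBits B n) ≡ n
fromBits-toBits zero    n<1    = sym (n<1⇒n≡0 n<1)
fromBits-toBits (suc B) {n} n<2^B+1 =
  trans (cong (λ k → toℕ𝔹 (odd n) + twice k) (fromBits-toBits B ⌊n/2⌋<2^B)) (odd+twice⌊n/2⌋≡n n)
  where
    ⌊n/2⌋<2^B : ⌊ n /2⌋ < 2 ^ B
    ⌊n/2⌋<2^B = ⌊n/2⌋<m (2 ^ B) (subst (n <_) (sym (twice≡2* (2 ^ B))) n<2^B+1)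

n<2^[1+⌊log₂n⌋] : ∀ n → n < 2 ^ suc ⌊log₂ n ⌋
n<2^[1+⌊log₂n⌋] n = ≰⇒> λ 2^[1+⌊log₂n⌋]≤n →
  1+n≰n (subst (_≤ ⌊log₂ n ⌋) (⌊log₂[2^n]⌋≡n (suc ⌊log₂ n ⌋)) (⌊log₂⌋-mono-≤ 2^[1+⌊log₂n⌋]≤n))

record Summary : Set where
  constructor ⟨_,_,_⟩
  field
    offset       : ℕ
    first second : Bool

open Summary

shiftRight : Summary → Summary
shiftRight ⟨ p , a , b ⟩ = ⟨ suc p , a , b ⟩

encode : ∀ B → Summary → Vec Bool (2 + B)
encode B ⟨ p , a , b ⟩ = a ∷ b ∷ toBits B p

decode : ∀ {B} → Vec Bool (2 + B) → Summary
decode (a ∷ b ∷ v) = ⟨ fromBits v , a , b ⟩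

decode-encode : ∀ B (s : Summary) → offset s < 2 ^ B → decode (encode B s) ≡ s
decode-encode B ⟨ p , a , b ⟩ p<2^B = cong ⟨_, a , b ⟩ (fromBits-toBits B p<2^B)

MirrorSymmetric : ℕ → Set
MirrorSymmetric N = ∀ a b c → localRule N a b c ≡ localRule N c b a

record Shields (N : ℕ) (σ : Bool → Bool) : Set where
  field
    left-inert  : ∀ x a → localRule N x a (σ a) ≡ localRule N false a (σ a)
    right-inert : ∀ a y → localRule N a (σ a) y ≡ localRule N a (σ a) false
    persistent  : ∀ a → localRule N a (σ a) false ≡ σ (localRule N false a (σ a))

∀-Bool? : {P : Bool → Set} → (∀ b → Dec (P b)) → Dec (∀ b → P b)
∀-Bool? P? = map′ (λ (pf , pt) → λ { false → pf ; true → pt }) (λ ∀P → ∀P false , ∀P true)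
                  (P? false ×-dec P? true)

mirrorSymmetric? : ∀ N → Dec (MirrorSymmetric N)
mirrorSymmetric? N = ∀-Bool? λ a → ∀-Bool? λ b → ∀-Bool? λ c → localRule N a b c ≟ localRule N c b a

shields? : ∀ N σ → Dec (Shields N σ)
shields? N σ =
  map′ (λ (l , r , p) → record { left-inert = l ; right-inert = r ; persistent = p })
       (λ s → Shields.left-inert s , Shields.right-inert s , Shields.persistent s)
       (  (∀-Bool? λ x → ∀-Bool? λ a → localRule N x a (σ a) ≟ localRule N false a (σ a))
    ×-dec (∀-Bool? λ a → ∀-Bool? λ y → localRule N a (σ a) y ≟ localRule N a (σ a) false)
    ×-dec (∀-Bool? λ a → localRule N a (σ a) false ≟ σ (localRule N false a (σ a))))

module Shielding {N : ℕ} {σ : Bool → Bool} (shields : Shields N σ) (mirror : MirrorSymmetric N) where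
  open Shields shields

  stepList : List Bool → List Bool
  stepList (a ∷ b ∷ c ∷ r) = localRule N a b c ∷ stepList (b ∷ c ∷ r)
  stepList _               = []

  iterList : ℕ → List Bool → List Bool
  iterList zero    u = u
  iterList (suc n) u = iterList n (stepList u)

  iterList-+ : ∀ k l u → iterList (k + l) u ≡ iterList l (iterList k u)
  iterList-+ zero    l u = refl
  iterList-+ (suc k) l u = iterList-+ k l (stepList u)

  length-stepList : ∀ a b r → length (stepList (a ∷ b ∷ r)) ≡ length r
  length-stepList a b []      = refl
  length-stepList a b (c ∷ r) = cong suc (length-stepList b c r)

  stepList-across-shield : ∀ x a c r →
    stepList (x ∷ a ∷ σ a ∷ c ∷ r) ≡
      localRule N false a (σ a) ∷ σ (localRule N false a (σ a)) ∷ stepList (σ a ∷ c ∷ r)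
  stepList-across-shield x a c r =
    cong₂ _∷_ (left-inert x a) (cong (_∷ stepList (σ a ∷ c ∷ r)) (trans (right-inert a c) (persistent a)))

  stepList-shield-screens : ∀ x y a r → stepList (x ∷ a ∷ σ a ∷ r) ≡ stepList (y ∷ a ∷ σ a ∷ r)
  stepList-shield-screens x y a []      = cong (_∷ []) (trans (left-inert x a) (sym (left-inert y a)))
  stepList-shield-screens x y a (c ∷ r) = cong (_∷ _) (trans (left-inert x a) (sym (left-inert y a)))

  -- Shielded k m u v: u and v differ at most in their first k cells, which are followed by
  -- a shield and m further cells.
  data Shielded : ℕ → ℕ → List Bool → List Bool → Set where
    shield : ∀ {m} a b r → b ≡ σ a → length r ≡ m → Shielded 0 m (a ∷ b ∷ r) (a ∷ b ∷ r)
    prefix : ∀ {k m u v} x y → Shielded k m u v → Shielded (suc k) m (x ∷ u) (y ∷ v)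

  length-Shielded : ∀ {k m u v} → Shielded k m u v → length u ≡ k + suc (suc m)
  length-Shielded (shield a b r _ refl) = refl
  length-Shielded (prefix x y t)        = cong suc (length-Shielded t)

  Shielded-step : ∀ {k m u v} → Shielded (suc k) (suc m) u v → Shielded k m (stepList u) (stepList v)
  Shielded-step (prefix x y (shield a _ [] refl ()))
  Shielded-step (prefix x y (shield a _ (c ∷ r) refl refl)) =
    subst₂ (Shielded 0 _) (sym (stepList-across-shield x a c r)) (sym (stepList-across-shield y a c r))
      (shield _ _ _ refl (length-stepList (σ a) c r))
  Shielded-step (prefix x y t@(prefix _ _ (shield _ _ _ _ _))) = prefix _ _ (Shielded-step t)
  Shielded-step (prefix x y t@(prefix _ _ (prefix _ _ _)))     = prefix _ _ (Shielded-step t)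

  Shielded-iterList : ∀ {k m u v} → Shielded k m u v → k ≤ suc m → iterList k u ≡ iterList k v
  Shielded-iterList (shield _ _ _ _ _) _ = refl
  Shielded-iterList (prefix x y (shield a _ r refl _)) _ = stepList-shield-screens x y a r
  Shielded-iterList {m = zero}  (prefix _ _ (prefix _ _ _)) (s≤s ())
  Shielded-iterList {m = suc m} t@(prefix _ _ (prefix _ _ _)) (s≤s k≤m) =
    Shielded-iterList (Shielded-step t) k≤m

  Shielded⇒iterList≡ : ∀ {k m u v} n → Shielded k m u v → k ≤ n → length u ≡ suc (twice n) →
    iterList n u ≡ iterList n v
  Shielded⇒iterList≡ {k} {m} {u} {v} n t k≤n length≡ = begin
    iterList n u                    ≡⟨ cong (λ l → iterList l u) (m+[n∸m]≡n k≤n) ⟨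
    iterList (k + (n ∸ k)) u        ≡⟨ iterList-+ k (n ∸ k) u ⟩
    iterList (n ∸ k) (iterList k u) ≡⟨ cong (iterList (n ∸ k)) (Shielded-iterList t k≤1+m) ⟩
    iterList (n ∸ k) (iterList k v) ≡⟨ iterList-+ k (n ∸ k) v ⟨
    iterList (k + (n ∸ k)) v        ≡⟨ cong (λ l → iterList l v) (m+[n∸m]≡n k≤n) ⟩
    iterList n v                    ∎
    where
      open ≡-Reasoning
      k≤1+m : k ≤ suc m
      k≤1+m = k+[2+m]≡1+2n∧k≤n⇒k≤1+m (trans (sym (length-Shielded t)) length≡) k≤n

  isShield : Bool → Bool → Bool
  isShield a b = does (b ≟ σ a)

  isShield⇒≡σ : ∀ a b → isShield a b ≡ true → b ≡ σ a
  isShield⇒≡σ a b _ with b ≟ σ a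
  ... | yes b≡σa = b≡σa

  ¬isShield⇒≡not∘σ : ∀ a b → isShield a b ≡ false → b ≡ not (σ a)
  ¬isShield⇒≡not∘σ a b _ with b ≟ σ a
  ... | no b≢σa = ¬-not b≢σa

  containsShield : List Bool → Bool
  containsShield (a ∷ b ∷ r) = isShield a b ∨ containsShield (b ∷ r)
  containsShield _           = false

  -- The offset of the last shield together with its two cells; for a shield-free word,
  -- offset 0 and its first two cells.
  summary : List Bool → Summary
  summary []          = ⟨ 0 , false , false ⟩
  summary (a ∷ [])    = ⟨ 0 , a , false ⟩
  summary (a ∷ b ∷ r) = if containsShield (b ∷ r) then shiftRight (summary (b ∷ r)) else ⟨ 0 , a , b ⟩

  unroll : Bool → ℕ → List Bool
  unroll b zero    = []
  unroll b (suc k) = b ∷ unroll (not (σ b)) k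

  expand : ℕ → Summary → List Bool
  expand zero    _                 = []
  expand (suc L) ⟨ zero  , a , b ⟩ = a ∷ unroll b L
  expand (suc L) ⟨ suc p , a , b ⟩ = false ∷ expand L ⟨ p , a , b ⟩

  offset-summary≤length : ∀ w → offset (summary w) ≤ length w
  offset-summary≤length []          = z≤n
  offset-summary≤length (a ∷ [])    = z≤n
  offset-summary≤length (a ∷ b ∷ r) with offset-summary≤length (b ∷ r) | containsShield (b ∷ r)
  ... | offset≤ | true  = s≤s offset≤
  ... | _       | false = z≤n

  unroll-shieldFree : ∀ b r → containsShield (b ∷ r) ≡ false → unroll b (suc (length r)) ≡ b ∷ r
  unroll-shieldFree b []      _    = refl
  unroll-shieldFree b (c ∷ r) free = cong (b ∷_) (begin
    unroll (not (σ b)) (suc (length r)) ≡⟨ cong (λ c′ → unroll c′ (suc (length r))) c≡ ⟨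
    unroll c (suc (length r))           ≡⟨ unroll-shieldFree c r (∨-conicalʳ _ _ free) ⟩
    c ∷ r                               ∎)
    where
      open ≡-Reasoning
      c≡ : c ≡ not (σ b)
      c≡ = ¬isShield⇒≡not∘σ b c (∨-conicalˡ _ _ free)

  expand-summary-shieldFree : ∀ w → containsShield w ≡ false → expand (length w) (summary w) ≡ w
  expand-summary-shieldFree []          _    = refl
  expand-summary-shieldFree (a ∷ [])    _    = refl
  expand-summary-shieldFree (a ∷ b ∷ r) free
    rewrite ∨-conicalʳ (isShield a b) _ free = cong (a ∷_) (unroll-shieldFree b r (∨-conicalʳ _ _ free))

  expand-summary-shielded : ∀ w ys → containsShield w ≡ true →
    Σ ℕ λ m → Shielded (offset (summary w)) m (w ++ ys) (expand (length w) (summary w) ++ ys)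
  expand-summary-shielded (a ∷ b ∷ r) ys shielded
    with expand-summary-shielded (b ∷ r) ys | containsShield (b ∷ r) in eq
  ... | tail-shielded | true with tail-shielded eq
  ...   | m , t = m , prefix a false t
  expand-summary-shielded (a ∷ b ∷ r) ys shielded | _ | false =
    length (r ++ ys) ,
    subst (λ w → Shielded 0 (length (r ++ ys)) (a ∷ b ∷ r ++ ys) (a ∷ w ++ ys)) (sym (unroll-shieldFree b r eq))
      (shield a b (r ++ ys) (isShield⇒≡σ a b (trans (sym (∨-identityʳ _)) shielded)) refl)

  iterList-expand-summary : ∀ n xs ys → length xs ≤ n → length (xs ++ ys) ≡ suc (twice n) →
    iterList n (xs ++ ys) ≡ iterList n (expand (length xs) (summary xs) ++ ys)
  iterList-expand-summary n xs ys xs≤n length≡ with containsShield xs in eq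
  ... | false = cong (λ w → iterList n (w ++ ys)) (sym (expand-summary-shieldFree xs eq))
  ... | true with expand-summary-shielded xs ys eq
  ...   | _ , t = Shielded⇒iterList≡ n t (≤-trans (offset-summary≤length xs) xs≤n) length≡

  stepList-snoc : ∀ w a b c →
    stepList (w ++ a ∷ b ∷ c ∷ []) ≡ stepList (w ++ a ∷ b ∷ []) ++ localRule N a b c ∷ []
  stepList-snoc []              a b c = refl
  stepList-snoc (x ∷ [])        a b c = refl
  stepList-snoc (x ∷ y ∷ [])    a b c = cong (localRule N x y a ∷_) (stepList-snoc (y ∷ []) a b c)
  stepList-snoc (x ∷ y ∷ z ∷ w) a b c = cong (localRule N x y z ∷_) (stepList-snoc (y ∷ z ∷ w) a b c)

  stepList-reverse : ∀ u → stepList (reverse u) ≡ reverse (stepList u)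
  stepList-reverse []              = refl
  stepList-reverse (a ∷ [])        = refl
  stepList-reverse (a ∷ b ∷ [])    = refl
  stepList-reverse (a ∷ b ∷ c ∷ r) = begin
    stepList (reverse (a ∷ b ∷ c ∷ r))
      ≡⟨ cong stepList (reverse-++ (a ∷ b ∷ c ∷ []) r) ⟩
    stepList (reverse r ++ c ∷ b ∷ a ∷ [])
      ≡⟨ stepList-snoc (reverse r) c b a ⟩
    stepList (reverse r ++ c ∷ b ∷ []) ++ localRule N c b a ∷ []
      ≡⟨ cong₂ (λ u x → stepList u ++ x ∷ []) (reverse-++ (b ∷ c ∷ []) r) (mirror a b c) ⟨
    stepList (reverse (b ∷ c ∷ r)) ++ localRule N a b c ∷ []
      ≡⟨ cong (_++ localRule N a b c ∷ []) (stepList-reverse (b ∷ c ∷ r)) ⟩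
    reverse (stepList (b ∷ c ∷ r)) ++ localRule N a b c ∷ []
      ≡⟨ unfold-reverse (localRule N a b c) (stepList (b ∷ c ∷ r)) ⟨
    reverse (stepList (a ∷ b ∷ c ∷ r))
      ∎
    where open ≡-Reasoning

  iterList-reverse : ∀ n u → iterList n (reverse u) ≡ reverse (iterList n u)
  iterList-reverse zero    u = refl
  iterList-reverse (suc n) u = trans (cong (iterList n) (stepList-reverse u)) (iterList-reverse n (stepList u))

  iterList-expand-summaryʳ : ∀ n xs ys → length ys ≤ n → length (xs ++ ys) ≡ suc (twice n) →
    iterList n (xs ++ ys) ≡ reverse (iterList n (expand (length ys) (summary (reverse ys)) ++ reverse xs))
  iterList-expand-summaryʳ n xs ys ys≤n length≡ = begin
    iterList n (xs ++ ys)
      ≡⟨ reverse-involutive _ ⟨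
    reverse (reverse (iterList n (xs ++ ys)))
      ≡⟨ cong reverse (iterList-reverse n (xs ++ ys)) ⟨
    reverse (iterList n (reverse (xs ++ ys)))
      ≡⟨ cong (reverse ∘ iterList n) (reverse-++ xs ys) ⟩
    reverse (iterList n (reverse ys ++ reverse xs))
      ≡⟨ cong reverse (iterList-expand-summary n (reverse ys) (reverse xs) rys≤n length-reversed) ⟩
    reverse (iterList n (expand (length (reverse ys)) (summary (reverse ys)) ++ reverse xs))
      ≡⟨ cong (λ L → reverse (iterList n (expand L (summary (reverse ys)) ++ reverse xs))) (length-reverse ys) ⟩
    reverse (iterList n (expand (length ys) (summary (reverse ys)) ++ reverse xs))
      ∎
    where
      open ≡-Reasoning
      rys≤n : length (reverse ys) ≤ n
      rys≤n = subst (_≤ n) (sym (length-reverse ys)) ys≤n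
      length-reversed : length (reverse ys ++ reverse xs) ≡ suc (twice n)
      length-reversed = trans (cong length (sym (reverse-++ xs ys))) (trans (length-reverse (xs ++ ys)) length≡)

  toList-step : ∀ {m} (v : Vec Bool (2 + m)) → toList (step N v) ≡ stepList (toList v)
  toList-step {zero}  (a ∷ b ∷ [])    = refl
  toList-step {suc m} (a ∷ b ∷ c ∷ v) = cong (localRule N a b c ∷_) (toList-step (b ∷ c ∷ v))

  toList-iterF : ∀ n {m} (v : Vec Bool (twice n + m)) → toList (iterF N n v) ≡ iterList n (toList v)
  toList-iterF zero    v = refl
  toList-iterF (suc n) v = trans (toList-iterF n (step N v)) (cong (iterList n) (toList-step v))

  cell : List Bool → Bool
  cell = fromMaybe false ∘ List.head

  splitPred : ∀ n {i j} → i + j ≡ twice n + 1 → Vec Bool i → Vec Bool j → Bool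
  splitPred n e x y = Pred N n (subst (Vec Bool) e (x Vec.++ y))

  splitPred≡cell : ∀ n {i j} (e : i + j ≡ twice n + 1) (x : Vec Bool i) (y : Vec Bool j) →
    splitPred n e x y ≡ cell (iterList n (toList x ++ toList y))
  splitPred≡cell n e x y = trans (head≡cell (iterF N n _))
    (cong cell (trans (toList-iterF n _) (cong (iterList n) (trans (toList-subst e) (toList-++ x y)))))
    where
      head≡cell : (w : Vec Bool 1) → head w ≡ cell (toList w)
      head≡cell (z ∷ []) = refl
      toList-subst : ∀ {k l} {v : Vec Bool k} (k≡l : k ≡ l) → toList (subst (Vec Bool) k≡l v) ≡ toList v
      toList-subst refl = refl

  length-split : ∀ n {i j} → i + j ≡ twice n + 1 → (x : Vec Bool i) (y : Vec Bool j) →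
    length (toList x ++ toList y) ≡ suc (twice n)
  length-split n {i} {j} length≡ x y = begin
    length (toList x ++ toList y)          ≡⟨ length-++ (toList x) ⟩
    length (toList x) + length (toList y)  ≡⟨ cong₂ _+_ (length-toList x) (length-toList y) ⟩
    i + j                                  ≡⟨ length≡ ⟩
    twice n + 1                            ≡⟨ +-comm (twice n) 1 ⟩
    suc (twice n)                          ∎
    where open ≡-Reasoning

  D₂≤-splitPred-left : ∀ n {i j} (e : i + j ≡ twice n + 1) → i ≤ n →
    D₂≤ (splitPred n e) (4 + ⌊log₂ n ⌋)
  D₂≤-splitPred-left n {i} {j} e i≤n =
    D₂≤-cong correct (D₂≤-oneWay (2 + B) (encode B ∘ summary ∘ toList) answer)
    where
      B : ℕ
      B = suc ⌊log₂ n ⌋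
      answer : Vec Bool (2 + B) → Vec Bool j → Bool
      answer s y = cell (iterList n (expand i (decode s) ++ toList y))
      correct : ∀ x y → answer (encode B (summary (toList x))) y ≡ splitPred n e x y
      correct x y = begin
        cell (iterList n (expand i (decode (encode B (summary xs))) ++ ys))
          ≡⟨ cong (λ s → cell (iterList n (expand i s ++ ys))) (decode-encode B (summary xs) offset<2^B) ⟩
        cell (iterList n (expand i (summary xs) ++ ys))
          ≡⟨ cong (λ L → cell (iterList n (expand L (summary xs) ++ ys))) (length-toList x) ⟨
        cell (iterList n (expand (length xs) (summary xs) ++ ys))
          ≡⟨ cong cell (iterList-expand-summary n xs ys xs≤n (length-split n e x y)) ⟨
        cell (iterList n (xs ++ ys))
          ≡⟨ splitPred≡cell n e x y ⟨
        splitPred n e x y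
          ∎
        where
          open ≡-Reasoning
          xs ys : List Bool
          xs = toList x
          ys = toList y
          xs≤n : length xs ≤ n
          xs≤n = subst (_≤ n) (sym (length-toList x)) i≤n
          offset<2^B : offset (summary xs) < 2 ^ B
          offset<2^B = ≤-<-trans (≤-trans (offset-summary≤length xs) xs≤n) (n<2^[1+⌊log₂n⌋] n)

  D₂≤-splitPred-right : ∀ n {i j} (e : i + j ≡ twice n + 1) → j ≤ n →
    D₂≤ (splitPred n e) (4 + ⌊log₂ n ⌋)
  D₂≤-splitPred-right n {i} {j} e j≤n =
    D₂≤-cong correct (D₂≤-flip (D₂≤-oneWay (2 + B) (encode B ∘ summary ∘ reverse ∘ toList) answer))
    where
      B : ℕ
      B = suc ⌊log₂ n ⌋
      answer : Vec Bool (2 + B) → Vec Bool i → Bool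
      answer s x = cell (reverse (iterList n (expand j (decode s) ++ reverse (toList x))))
      correct : ∀ x y → answer (encode B (summary (reverse (toList y)))) x ≡ splitPred n e x y
      correct x y = begin
        cell (reverse (iterList n (expand j (decode (encode B (summary rys))) ++ reverse xs)))
          ≡⟨ cong (λ s → cell (reverse (iterList n (expand j s ++ reverse xs))))
                  (decode-encode B (summary rys) offset<2^B) ⟩
        cell (reverse (iterList n (expand j (summary rys) ++ reverse xs)))
          ≡⟨ cong (λ L → cell (reverse (iterList n (expand L (summary rys) ++ reverse xs)))) (length-toList y) ⟨
        cell (reverse (iterList n (expand (length ys) (summary rys) ++ reverse xs)))
          ≡⟨ cong cell (iterList-expand-summaryʳ n xs ys ys≤n (length-split n e x y)) ⟨
        cell (iterList n (xs ++ ys))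
          ≡⟨ splitPred≡cell n e x y ⟨
        splitPred n e x y
          ∎
        where
          open ≡-Reasoning
          xs ys rys : List Bool
          xs  = toList x
          ys  = toList y
          rys = reverse ys
          ys≤n : length ys ≤ n
          ys≤n = subst (_≤ n) (sym (length-toList y)) j≤n
          offset<2^B : offset (summary rys) < 2 ^ B
          offset<2^B = ≤-<-trans (≤-trans (offset-summary≤length rys) rys≤n) (n<2^[1+⌊log₂n⌋] n)
            where
              rys≤n : length rys ≤ n
              rys≤n = subst (_≤ n) (sym (length-reverse ys)) ys≤n

  D₂≤-splitPred : ∀ n {i j} (e : i + j ≡ twice n + 1) → D₂≤ (splitPred n e) (4 + ⌊log₂ n ⌋)
  D₂≤-splitPred n {i} e with i ≤? n
  ... | yes i≤n = D₂≤-splitPred-left n e i≤n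
  ... | no  i≰n = D₂≤-splitPred-right n e (n+m≡2k+1∧n≰k⇒m≤k e i≰n)

  D≤-Pred : ∀ n → 2 ≤ n → D≤ (Pred N n) (5 * ⌊log₂ n ⌋)
  D≤-Pred n 2≤n i j e = D₂≤-mono (4+n≤5*n (⌊log₂⌋-mono-≤ 2≤n)) (D₂≤-splitPred n e)

D≤-Pred-logarithmic : ∀ N (σ : Bool → Bool) {_ : True (shields? N σ)} {_ : True (mirrorSymmetric? N)} →
  Σ ℕ λ c → Σ ℕ λ n₀ → (n : ℕ) → n₀ ≤ n → D≤ (Pred N n) (c * ⌊log₂ n ⌋)
D≤-Pred-logarithmic N σ {shields} {mirror} = 5 , 2 , Shielding.D≤-Pred (toWitness shields) (toWitness mirror)

proposition15 : (N : ℕ) → N ∈ (23 ∷ 50 ∷ 77 ∷ 178 ∷ 232 ∷ []) →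
    Σ ℕ λ c → Σ ℕ λ n₀ → (n : ℕ) → n₀ ≤ n → D≤ (Pred N n) (c * ⌊log₂ n ⌋)
proposition15 _ (here refl)                                 = D≤-Pred-logarithmic 23  id
proposition15 _ (there (here refl))                         = D≤-Pred-logarithmic 50  not
proposition15 _ (there (there (here refl)))                 = D≤-Pred-logarithmic 77  not
proposition15 _ (there (there (there (here refl))))         = D≤-Pred-logarithmic 178 not
proposition15 _ (there (there (there (there (here refl))))) = D≤-Pred-logarithmic 232 id
proposition15 _ (there (there (there (there (there ())))))
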